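{- A connected block-cactus graph $G$ is $1$-perfectly orientable if and only if at most one block of $G$ is a cycle of length at least four.
   Context: All graphs are finite and simple. A graph is biconnected if it is connected and has no cut vertex; a block is a maximal biconnected subgraph. A block-cactus graph is a graph each of whose blocks is either a cycle or a complete graph. An orientation $D$ of a graph $G$ is $1$-perfect if for every vertex $v$, the out-neighborhood of $v$ in $D$ is a clique in $G$; $G$ is $1$-perfectly orientable if it has a $1$-perfect orientation. -}

module Defs where

open import Data.Nat using (ℕ; zero; suc; _≤_)
open import Data.Fin using (Fin; toℕ; _≟_)
open import Data.Bool using (Bool; true; false; _∧_; not)
open import Data.Product using (Σ; ∃; _×_; _,_)
open import Data.Sum using (_⊎_)
open import Relation.Nullary using (¬_)
open import Relation.Nullary.Decidable using (⌊_⌋)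
open import Relation.Binary.PropositionalEquality using (_≡_; _≢_)
open import Function.Bundles using (_⇔_)

record Graph (n : ℕ) : Set where
  field
    adj    : Fin n → Fin n → Bool
    sym    : ∀ x y → adj x y ≡ adj y x
    irrefl : ∀ x → adj x x ≡ false
open Graph public

record Sub (n : ℕ) : Set where
  constructor sub
  field
    vs : Fin n → Bool
    es : Fin n → Fin n → Bool
open Sub public

IsSubgraph : ∀ {n} → Graph n → Sub n → Set
IsSubgraph G H =
  (∀ x y → es H x y ≡ es H y x) ×
  (∀ x y → es H x y ≡ true → adj G x y ≡ true) ×
  (∀ x y → es H x y ≡ true → vs H x ≡ true)

whole : ∀ {n} → Graph n → Sub n
whole G = sub (λ _ → true) (adj G)

data Walk {n : ℕ} (H : Sub n) : Fin n → Fin n → Set where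
  here : ∀ {x} → vs H x ≡ true → Walk H x x
  step : ∀ {x y z} → vs H x ≡ true → es H x y ≡ true → Walk H y z → Walk H x z

AllJoined : ∀ {n} → Sub n → Set
AllJoined H = ∀ x y → vs H x ≡ true → vs H y ≡ true → Walk H x y

Connected : ∀ {n} → Sub n → Set
Connected H = (∃ λ x → vs H x ≡ true) × AllJoined H

deleteV : ∀ {n} → Sub n → Fin n → Sub n
deleteV H v = sub (λ x → vs H x ∧ not ⌊ x ≟ v ⌋)
                  (λ x y → es H x y ∧ (not ⌊ x ≟ v ⌋ ∧ not ⌊ y ≟ v ⌋))

IsCutVertex : ∀ {n} → Sub n → Fin n → Set
IsCutVertex H v = (vs H v ≡ true) × ¬ AllJoined (deleteV H v)

Biconnected : ∀ {n} → Sub n → Set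
Biconnected H = Connected H × (∀ v → ¬ IsCutVertex H v)

_⊑_ : ∀ {n} → Sub n → Sub n → Set
H ⊑ H' = (∀ x → vs H x ≡ true → vs H' x ≡ true) ×
         (∀ x y → es H x y ≡ true → es H' x y ≡ true)

IsBlock : ∀ {n} → Graph n → Sub n → Set
IsBlock G H = IsSubgraph G H × Biconnected H ×
  (∀ H' → IsSubgraph G H' → Biconnected H' → H ⊑ H' → H' ⊑ H)

IsComplete : ∀ {n} → Sub n → Set
IsComplete H = ∀ x y → vs H x ≡ true → vs H y ≡ true → x ≢ y → es H x y ≡ true

NextMod : (k : ℕ) → Fin k → Fin k → Set
NextMod k i j = (suc (toℕ i) ≡ toℕ j) ⊎ ((suc (toℕ i) ≡ k) × (toℕ j ≡ zero))

CycAdj : (k : ℕ) → Fin k → Fin k → Set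
CycAdj k i j = NextMod k i j ⊎ NextMod k j i

IsCycleOfLength : ∀ {n} → Sub n → ℕ → Set
IsCycleOfLength {n} H k = (3 ≤ k) × Σ (Fin k → Fin n) λ f →
  (∀ i j → f i ≡ f j → i ≡ j) ×
  (∀ i → vs H (f i) ≡ true) ×
  (∀ x → vs H x ≡ true → ∃ λ i → f i ≡ x) ×
  (∀ i j → (es H (f i) (f j) ≡ true) ⇔ CycAdj k i j)

IsCycle : ∀ {n} → Sub n → Set
IsCycle H = ∃ λ k → IsCycleOfLength H k

IsLongCycle : ∀ {n} → Sub n → Set
IsLongCycle H = ∃ λ k → (4 ≤ k) × IsCycleOfLength H k

ConnectedGraph : ∀ {n} → Graph n → Set
ConnectedGraph G = Connected (whole G)

BlockCactus : ∀ {n} → Graph n → Set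
BlockCactus G = ∀ H → IsBlock G H → IsCycle H ⊎ IsComplete H

IsOrientation : ∀ {n} → Graph n → (Fin n → Fin n → Bool) → Set
IsOrientation G D =
  (∀ x y → D x y ≡ true → adj G x y ≡ true) ×
  (∀ x y → adj G x y ≡ true →
     ((D x y ≡ true) × (D y x ≡ false)) ⊎ ((D x y ≡ false) × (D y x ≡ true)))

IsOnePerfect : ∀ {n} → Graph n → (Fin n → Fin n → Bool) → Set
IsOnePerfect G D = ∀ v x y → D v x ≡ true → D v y ≡ true → x ≢ y → adj G x y ≡ true

OnePerfectlyOrientable : ∀ {n} → Graph n → Set
OnePerfectlyOrientable G = ∃ λ D → IsOrientation G D × IsOnePerfect G D

SameSub : ∀ {n} → Sub n → Sub n → Set
SameSub H H' = (∀ x → vs H x ≡ vs H' x) × (∀ x y → es H x y ≡ es H' x y)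

AtMostOneLongCycleBlock : ∀ {n} → Graph n → Set
AtMostOneLongCycleBlock G = ∀ B B' → IsBlock G B → IsBlock G B' →
  IsLongCycle B → IsLongCycle B' → SameSub B B'

-- Let D be a 1-perfect orientation and B a block that is a cycle of length at least four.
-- If an edge of B points backwards along the cycle, the next one must too, since otherwise two
-- cycle vertices at distance two would be adjacent out-neighbours, i.e. B would have a chord; so
-- every vertex of B has an out-neighbour in B. Out-neighbourhoods are cliques and a triangle
-- sharing an edge with a block lies in it, so all out-neighbours of a vertex of B lie in B. By
-- induction on the distance to B, no arc leads one step farther from B; walking from a second
-- long cycle block B′ towards B along arcs therefore stays in B′ and reaches B, and B′ then
-- shares an arc with B, so B′ = B.
--
-- Conversely, orient every edge towards the endpoint closer to a vertex set S, breaking ties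
-- by some fixed rule. This fails to be 1-perfect at a vertex v ∉ S only if v has non-adjacent
-- neighbours y, z not farther from S. Descending from y and z to S and joining inside S avoids v
-- and closes a cycle through v, y and z; its block contains the non-adjacent pair y, z, hence in
-- a block-cactus graph is a long cycle through v. Starting from a single vertex S either works or
-- exhibits a long cycle block C; in the latter case take S = C, oriented cyclically, since no
-- other long cycle block can pass through a vertex outside C.

module Submission where

open import Defs hiding (sym)
open import Level using (Level)
open import Data.Nat using (ℕ; zero; suc; _≤_; _<_; z≤n; s≤s)
open import Data.Nat.Properties
  using (≤-refl; ≰⇒>; <⇒≤; <-irrefl; 1+n≢n; m≢1+n+m; ≤-antisym; ≮⇒≥; ≤-pred; n≤0⇒n≡0;
         <-≤-trans; n<1+n; ≤-reflexive; m≤n⇒m<n∨m≡n; <-cmp; <-asym; n≢0⇒n>0)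
open import Data.Fin using (Fin; zero; suc; toℕ; _≟_)
import Data.Fin as Fin
import Data.Fin.Properties as Fin
open import Data.Fin.Properties
  using (any?; all?; pigeonhole; toℕ-injective; toℕ<n; toℕ-fromℕ<; toℕ-fromℕ; toℕ-inject₁; ≤fromℕ)
open import Data.Fin.Induction using (<-weakInduction; <-weakInduction-startingFrom)
open import Data.Bool using (Bool; true; false; _∧_; _∨_; not; if_then_else_)
open import Data.Bool.Properties using (∧-comm; ∧-distribʳ-∨; ∧-zeroʳ) renaming (_≟_ to _≟ᴮ_)
open import Data.Product using (Σ; ∃; _×_; _,_; proj₁; proj₂)
open import Data.Sum using (_⊎_; inj₁; inj₂; [_,_]′)
open import Data.Empty using (⊥-elim)
open import Data.List using (List; []; _∷_; _++_; [_]; length; lookup; cartesianProductWith)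
open import Data.List.Membership.Propositional using (_∈_)
open import Data.List.Membership.Propositional.Properties
  using (∈-++⁺ˡ; ∈-++⁺ʳ; ∈-++⁻; ∈-∃++; ∈-lookup; ∈-cartesianProductWith⁺)
open import Data.List.Properties using (++-assoc)
open import Data.List.Relation.Unary.Any using (here; there)
import Data.List.Relation.Unary.Any as Any
open import Data.List.Relation.Binary.Permutation.Propositional.Properties using (∈-resp-↭; ++-comm; shift)
import Data.List.Relation.Unary.All as All
open import Data.List.Relation.Unary.All.Properties using (¬Any⇒All¬)
open import Data.List.Relation.Unary.All using ([]; _∷_)
open import Data.List.Relation.Unary.AllPairs using ([]; _∷_)
open import Data.List.Relation.Unary.Unique.Propositional using (Unique)
open import Data.List.Relation.Unary.Linked as Linked using (Linked; []; [-]; _∷_)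
open import Relation.Nullary using (¬_; Dec; yes; no; contradiction)
open import Relation.Binary.Definitions using (tri<; tri≈; tri>)
open import Relation.Nullary.Decidable using (⌊_⌋; _×-dec_; _⊎-dec_; _→-dec_; ¬?; decidable-stable)
import Data.Vec.Functional as Vector
open import Relation.Binary.PropositionalEquality
  using (_≡_; _≢_; refl; sym; trans; cong; cong₂; subst; subst₂)
open import Function using (_∘_; flip)
open import Function.Bundles using (_⇔_; Equivalence; mk⇔)

private variable
  ℓ : Level
  P : Set ℓ
  a : Bool
  n : ℕ
  x y z c s t u v w : Fin n
  G : Graph n
  A B B′ C H K : Sub n
  X Y L : List (Fin n)
  S : Fin n → Bool
  k : ℕ

∧-true⁻ˡ : ∀ {a b} → a ∧ b ≡ true → a ≡ true
∧-true⁻ˡ {true} _ = refl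

∧-true⁻ʳ : ∀ {a b} → a ∧ b ≡ true → b ≡ true
∧-true⁻ʳ {true} p = p

∧-true⁺ : ∀ {a b} → a ≡ true → b ≡ true → a ∧ b ≡ true
∧-true⁺ refl refl = refl

∨-true⁻ : ∀ {a b} → a ∨ b ≡ true → a ≡ true ⊎ b ≡ true
∨-true⁻ {true} _ = inj₁ refl
∨-true⁻ {false} p = inj₂ p

∨-true⁺ˡ : ∀ {a b} → a ≡ true → a ∨ b ≡ true
∨-true⁺ˡ refl = refl

∨-true⁺ʳ : ∀ {a b} → b ≡ true → a ∨ b ≡ true
∨-true⁺ʳ {true} _ = refl
∨-true⁺ʳ {false} p = p

true⇒≢false : a ≡ true → a ≢ false
true⇒≢false refl ()

≡-from-truth : ∀ {a b} → (a ≡ true → b ≡ true) → (b ≡ true → a ≡ true) → a ≡ b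
≡-from-truth {true} f _ = sym (f refl)
≡-from-truth {false} {true} _ g = g refl
≡-from-truth {false} {false} _ _ = refl

isYes-true⁺ : (p? : Dec P) → P → ⌊ p? ⌋ ≡ true
isYes-true⁺ (yes _) _ = refl
isYes-true⁺ (no ¬p) p = ⊥-elim (¬p p)

isYes-false⁺ : (p? : Dec P) → ¬ P → ⌊ p? ⌋ ≡ false
isYes-false⁺ (yes p) ¬p = ⊥-elim (¬p p)
isYes-false⁺ (no _) _ = refl

isYes-true⁻ : (p? : Dec P) → ⌊ p? ⌋ ≡ true → P
isYes-true⁻ (yes p) _ = p
isYes-true⁻ (no _) ()

≢⇒not-≟ : x ≢ y → not ⌊ x ≟ y ⌋ ≡ true
≢⇒not-≟ {x = x} {y} x≢y = cong not (isYes-false⁺ (x ≟ y) x≢y)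

not-≟⇒≢ : not ⌊ x ≟ y ⌋ ≡ true → x ≢ y
not-≟⇒≢ {x = x} {y} with x ≟ y
... | yes _ = λ ()
... | no x≢y = λ _ → x≢y

anyᶠ : (Fin n → Bool) → Bool
anyᶠ f = ⌊ any? (λ i → f i ≟ᴮ true) ⌋

anyᶠ-true⁺ : (f : Fin n → Bool) → f x ≡ true → anyᶠ f ≡ true
anyᶠ-true⁺ {x = x} f fx = isYes-true⁺ (any? (λ i → f i ≟ᴮ true)) (x , fx)

anyᶠ-true⁻ : (f : Fin n → Bool) → anyᶠ f ≡ true → ∃ λ x → f x ≡ true
anyᶠ-true⁻ f = isYes-true⁻ (any? (λ i → f i ≟ᴮ true))

SymmetricEdges : Sub n → Set
SymmetricEdges H = ∀ x y → es H x y ≡ true → es H y x ≡ true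

walk-source : Walk H x y → vs H x ≡ true
walk-source (here p) = p
walk-source (step p _ _) = p

infixr 5 _++ʷ_

_++ʷ_ : Walk H x y → Walk H y z → Walk H x z
here _ ++ʷ W = W
step p e W ++ʷ W′ = step p e (W ++ʷ W′)

reverseʷ : SymmetricEdges H → Walk H x y → Walk H y x
reverseʷ sym-H (here p) = here p
reverseʷ sym-H (step p e W) = reverseʷ sym-H W ++ʷ step (walk-source W) (sym-H _ _ e) (here p)

mapʷ : (∀ x → vs H x ≡ true → vs K x ≡ true) →
       (∀ x y → vs H x ≡ true → vs H y ≡ true → es H x y ≡ true → es K x y ≡ true) →
       Walk H x y → Walk K x y
mapʷ f g (here p) = here (f _ p)
mapʷ f g (step p e W) = step (f _ p) (g _ _ p (walk-source W) e) (mapʷ f g W)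

⊑-refl : H ⊑ H
⊑-refl = (λ _ p → p) , (λ _ _ p → p)

⊑-trans : A ⊑ B → B ⊑ K → A ⊑ K
⊑-trans (v₁ , e₁) (v₂ , e₂) = (λ x p → v₂ x (v₁ x p)) , (λ x y p → e₂ x y (e₁ x y p))

⊑-antisym : A ⊑ B → B ⊑ A → SameSub A B
⊑-antisym (v₁ , e₁) (v₂ , e₂) =
  (λ x → ≡-from-truth (v₁ x) (v₂ x)) , (λ x y → ≡-from-truth (e₁ x y) (e₂ x y))

SameSub⇒⊑ : SameSub A B → A ⊑ B
SameSub⇒⊑ (sv , se) = (λ x p → trans (sym (sv x)) p) , (λ x y p → trans (sym (se x y)) p)

SameSub⇒⊒ : SameSub A B → B ⊑ A
SameSub⇒⊒ (sv , se) = (λ x p → trans (sv x) p) , (λ x y p → trans (se x y) p)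

⊑-walk : A ⊑ B → Walk A x y → Walk B x y
⊑-walk (v , e) = mapʷ v (λ x y _ _ → e x y)

deleteV-mono : A ⊑ B → deleteV A w ⊑ deleteV B w
deleteV-mono {A = A} (v , e) =
  (λ x p → ∧-true⁺ (v x (∧-true⁻ˡ p)) (∧-true⁻ʳ {vs A x} p)) ,
  (λ x y p → ∧-true⁺ (e x y (∧-true⁻ˡ p)) (∧-true⁻ʳ {es A x y} p))

deleteV-reflects : (∀ x → vs B x ≡ true → vs A x ≡ true) →
                   ∀ x → vs (deleteV B w) x ≡ true → vs (deleteV A w) x ≡ true
deleteV-reflects {B = B} back x p = ∧-true⁺ (back x (∧-true⁻ˡ p)) (∧-true⁻ʳ {vs B x} p)

deleteV-sym : SymmetricEdges H → SymmetricEdges (deleteV H w)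
deleteV-sym {H = H} {w = w} sym-H x y p =
  ∧-true⁺ (sym-H x y (∧-true⁻ˡ p)) (∧-true⁺ (∧-true⁻ʳ {not ⌊ x ≟ w ⌋} q) (∧-true⁻ˡ q))
  where
  q : not ⌊ x ≟ w ⌋ ∧ not ⌊ y ≟ w ⌋ ≡ true
  q = ∧-true⁻ʳ {es H x y} p

AllJoined-grow : (∀ x → vs B x ≡ true → vs A x ≡ true) → A ⊑ B → AllJoined A → AllJoined B
AllJoined-grow back A⊑B joined x y Bx By = ⊑-walk A⊑B (joined x y (back x Bx) (back y By))

Biconnected-grow : (∀ x → vs B x ≡ true → vs A x ≡ true) → A ⊑ B → Biconnected A → Biconnected B
Biconnected-grow {B = B} {A = A} back A⊑B (((x , Ax) , joined) , no-cut) =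
  ((x , proj₁ A⊑B x Ax) , AllJoined-grow back A⊑B joined) ,
  λ w (Bw , ¬joined) → no-cut w (back w Bw , λ joined-w →
    ¬joined (AllJoined-grow (deleteV-reflects {B = B} {A = A} {w = w} back)
                            (deleteV-mono {w = w} A⊑B) joined-w))

Biconnected-SameSub : SameSub A B → Biconnected A → Biconnected B
Biconnected-SameSub A≅B = Biconnected-grow (proj₁ (SameSub⇒⊒ A≅B)) (SameSub⇒⊑ A≅B)

IsSubgraph-SameSub : SameSub A B → IsSubgraph G A → IsSubgraph G B
IsSubgraph-SameSub (sv , se) (s₁ , s₂ , s₃) =
  (λ x y → trans (sym (se x y)) (trans (s₁ x y) (se y x))) ,
  (λ x y p → s₂ x y (trans (se x y) p)) ,
  (λ x y p → trans (sym (sv x)) (s₃ x y (trans (se x y) p)))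

-- Only up to double negation, since a cut vertex is defined by ¬ AllJoined.
¬¬AllJoined-deleteV : Biconnected H → ∀ w → ¬ ¬ AllJoined (deleteV H w)
¬¬AllJoined-deleteV {H = H} ((_ , joined) , no-cut) w ¬joined with vs H w in Hw
... | true = no-cut w (Hw , ¬joined)
... | false = ¬joined λ a b Ha Hb →
  mapʷ (λ x Hx → ∧-true⁺ Hx (≠w x Hx))
       (λ x y Hx Hy e → ∧-true⁺ e (∧-true⁺ (≠w x Hx) (≠w y Hy)))
       (joined a b (∧-true⁻ˡ Ha) (∧-true⁻ˡ Hb))
  where
  ≠w : ∀ x → vs H x ≡ true → not ⌊ x ≟ w ⌋ ≡ true
  ≠w x Hx = ≢⇒not-≟ λ { refl → true⇒≢false Hx Hw }

-- Unions of biconnected subgraphs; blocks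

infixr 6 _∪ˢ_

_∪ˢ_ : Sub n → Sub n → Sub n
A ∪ˢ B = sub (λ x → vs A x ∨ vs B x) (λ x y → es A x y ∨ es B x y)

⊑-∪ˡ : A ⊑ (A ∪ˢ B)
⊑-∪ˡ = (λ _ → ∨-true⁺ˡ) , (λ _ _ → ∨-true⁺ˡ)

⊑-∪ʳ : B ⊑ (A ∪ˢ B)
⊑-∪ʳ {A = A} = (λ x → ∨-true⁺ʳ {vs A x}) , (λ x y → ∨-true⁺ʳ {es A x y})

IsSubgraph-∪ : IsSubgraph G A → IsSubgraph G B → IsSubgraph G (A ∪ˢ B)
IsSubgraph-∪ {A = A} (a₁ , a₂ , a₃) (b₁ , b₂ , b₃) =
  (λ x y → cong₂ _∨_ (a₁ x y) (b₁ x y)) ,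
  (λ x y p → [ a₂ x y , b₂ x y ]′ (∨-true⁻ {es A x y} p)) ,
  (λ x y p → [ (λ q → ∨-true⁺ˡ (a₃ x y q)) , (λ q → ∨-true⁺ʳ {vs A x} (b₃ x y q)) ]′
               (∨-true⁻ {es A x y} p))

deleteV-∪ : SameSub (deleteV A w ∪ˢ deleteV B w) (deleteV (A ∪ˢ B) w)
deleteV-∪ {A = A} {w = w} {B = B} =
  (λ x → sym (∧-distribʳ-∨ _ (vs A x) (vs B x))) ,
  (λ x y → sym (∧-distribʳ-∨ _ (es A x y) (es B x y)))

AllJoined-∪ : vs A c ≡ true → vs B c ≡ true → AllJoined A → AllJoined B → AllJoined (A ∪ˢ B)
AllJoined-∪ {A = A} {c = c} {B = B} Ac Bc joined-A joined-B x y p q =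
  to-c (∨-true⁻ {vs A x} p) ++ʷ from-c (∨-true⁻ {vs A y} q)
  where
  to-c : vs A x ≡ true ⊎ vs B x ≡ true → Walk (A ∪ˢ B) x c
  to-c (inj₁ Ax) = ⊑-walk ⊑-∪ˡ (joined-A x c Ax Ac)
  to-c (inj₂ Bx) = ⊑-walk (⊑-∪ʳ {A = A}) (joined-B x c Bx Bc)
  from-c : vs A y ≡ true ⊎ vs B y ≡ true → Walk (A ∪ˢ B) c y
  from-c (inj₁ Ay) = ⊑-walk ⊑-∪ˡ (joined-A c y Ac Ay)
  from-c (inj₂ By) = ⊑-walk (⊑-∪ʳ {A = A}) (joined-B c y Bc By)

AllJoined-SameSub : SameSub A B → AllJoined A → AllJoined B
AllJoined-SameSub A≅B = AllJoined-grow (proj₁ (SameSub⇒⊒ A≅B)) (SameSub⇒⊑ A≅B)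

Biconnected-∪ : Biconnected A → Biconnected B → x ≢ y →
                vs A x ≡ true → vs A y ≡ true → vs B x ≡ true → vs B y ≡ true →
                Biconnected (A ∪ˢ B)
Biconnected-∪ {A = A} {B = B} {x = x} {y = y} bA bB x≢y Ax Ay Bx By =
  ((x , ∨-true⁺ˡ Ax) , AllJoined-∪ Ax Bx (proj₂ (proj₁ bA)) (proj₂ (proj₁ bB))) ,
  λ w (_ , ¬joined) → ¬¬AllJoined-deleteV bA w λ joined-A → ¬¬AllJoined-deleteV bB w λ joined-B →
    let c , Ac , Bc , c≢w = survivor w in
    ¬joined (AllJoined-SameSub (deleteV-∪ {A = A} {w = w} {B = B})
               (AllJoined-∪ {A = deleteV A w} (∧-true⁺ Ac (≢⇒not-≟ c≢w))
                            (∧-true⁺ Bc (≢⇒not-≟ c≢w)) joined-A joined-B))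
  where
  survivor : ∀ w → ∃ λ c → vs A c ≡ true × vs B c ≡ true × c ≢ w
  survivor w with x ≟ w
  ... | no x≢w = x , Ax , Bx , x≢w
  ... | yes refl = y , Ay , By , x≢y ∘ sym

block-absorbs : IsBlock G B → IsSubgraph G H → Biconnected H → x ≢ y →
                vs B x ≡ true → vs B y ≡ true → vs H x ≡ true → vs H y ≡ true → H ⊑ B
block-absorbs {G = G} {B = B} {H = H} (sB , bB , maximal) sH bH x≢y Bx By Hx Hy =
  ⊑-trans (⊑-∪ʳ {A = B})
          (maximal (B ∪ˢ H) (IsSubgraph-∪ {G = G} sB sH) (Biconnected-∪ bB bH x≢y Bx By Hx Hy)
                   ⊑-∪ˡ)

blocks-coincide : IsBlock G B → IsBlock G B′ → x ≢ y →
                  vs B x ≡ true → vs B y ≡ true → vs B′ x ≡ true → vs B′ y ≡ true →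
                  SameSub B B′
blocks-coincide {G = G} {B = B} {B′ = B′} blB@(sB , bB , _) blB′@(sB′ , bB′ , _) x≢y
                Bx By B′x B′y =
  ⊑-antisym (block-absorbs {G = G} {B = B′} {H = B} blB′ sB bB x≢y B′x B′y Bx By)
            (block-absorbs {G = G} {B = B} {H = B′} blB sB′ bB′ x≢y Bx By B′x B′y)

Adj : Graph n → Fin n → Fin n → Set
Adj G x y = adj G x y ≡ true

adj-sym : Adj G x y → Adj G y x
adj-sym {G = G} {x = x} {y = y} xy = trans (Graph.sym G y x) xy

adj⇒≢ : Adj G x y → x ≢ y
adj⇒≢ {G = G} {x = x} xy refl = true⇒≢false xy (irrefl G x)

memᴮ : Fin n → List (Fin n) → Bool
memᴮ v L = ⌊ Any.any? (v ≟_) L ⌋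

∈⇒memᴮ : v ∈ L → memᴮ v L ≡ true
∈⇒memᴮ {v = v} {L = L} = isYes-true⁺ (Any.any? (v ≟_) L)

memᴮ⇒∈ : memᴮ v L ≡ true → v ∈ L
memᴮ⇒∈ {v = v} {L = L} = isYes-true⁻ (Any.any? (v ≟_) L)

induced : Graph n → List (Fin n) → Sub n
induced G L = sub (λ v → memᴮ v L) (λ u v → adj G u v ∧ (memᴮ u L ∧ memᴮ v L))

induced-IsSubgraph : IsSubgraph G (induced G L)
induced-IsSubgraph {G = G} {L = L} =
  (λ x y → cong₂ _∧_ (Graph.sym G x y) (∧-comm (memᴮ x L) (memᴮ y L))) ,
  (λ x y → ∧-true⁻ˡ) ,
  (λ x y p → ∧-true⁻ˡ (∧-true⁻ʳ {adj G x y} p))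

induced-sym : SymmetricEdges (induced G L)
induced-sym {G = G} {L = L} x y p = trans (sym (proj₁ (induced-IsSubgraph {G = G} {L = L}) x y)) p

Induced : Graph n → Sub n → Set
Induced G K = ∀ x y → vs K x ≡ true → vs K y ≡ true → Adj G x y → es K x y ≡ true

induced-Induced : Induced G (induced G L)
induced-Induced x y Lx Ly xy = ∧-true⁺ xy (∧-true⁺ Lx Ly)

deleteV-Induced : Induced G K → Induced G (deleteV K w)
deleteV-Induced {K = K} ind x y p q xy =
  ∧-true⁺ (ind x y (∧-true⁻ˡ p) (∧-true⁻ˡ q) xy)
          (∧-true⁺ (∧-true⁻ʳ {vs K x} p) (∧-true⁻ʳ {vs K y} q))

Linked-walk : Induced G K → ∀ {x} Q → Linked (Adj G) (x ∷ Q) →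
              (∀ v → v ∈ x ∷ Q → vs K v ≡ true) → v ∈ x ∷ Q → Walk K x v
Linked-walk ind Q chain inK (here refl) = here (inK _ (here refl))
Linked-walk {G = G} ind (y ∷ Q) (xy ∷ chain) inK (there v∈) =
  step (inK _ (here refl)) (ind _ _ (inK _ (here refl)) (inK _ (there (here refl))) xy)
       (Linked-walk {G = G} ind Q chain (λ v → inK v ∘ there) v∈)

Linked-AllJoined : Induced G K → SymmetricEdges K → Linked (Adj G) L →
                   (∀ v → v ∈ L → vs K v ≡ true) → (∀ v → vs K v ≡ true → v ∈ L) →
                   AllJoined K
Linked-AllJoined {L = []} _ _ _ _ covers x _ Kx _ with () ← covers x Kx
Linked-AllJoined {G = G} {L = q ∷ Q} ind sym-K chain inK covers x y Kx Ky =
  reverseʷ sym-K (Linked-walk {G = G} ind Q chain inK (covers x Kx)) ++ʷ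
  Linked-walk {G = G} ind Q chain inK (covers y Ky)

module _ {ℓ} {A : Set} {R : A → A → Set ℓ} where

  Linked-++⁻ˡ : ∀ xs {ys} → Linked R (xs ++ ys) → Linked R xs
  Linked-++⁻ˡ [] _ = []
  Linked-++⁻ˡ (x ∷ []) _ = [-]
  Linked-++⁻ˡ (x ∷ y ∷ xs) (r ∷ rs) = r ∷ Linked-++⁻ˡ (y ∷ xs) rs

  Linked-++⁻ʳ : ∀ xs {ys} → Linked R (xs ++ ys) → Linked R ys
  Linked-++⁻ʳ [] rs = rs
  Linked-++⁻ʳ (x ∷ xs) rs = Linked-++⁻ʳ xs (Linked.tail rs)

  Linked-glue : ∀ xs {x ys} → Linked R (xs ++ [ x ]) → Linked R (x ∷ ys) → Linked R (xs ++ x ∷ ys)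
  Linked-glue [] _ rs = rs
  Linked-glue (u ∷ []) (r ∷ [-]) rs = r ∷ rs
  Linked-glue (u ∷ v ∷ xs) (r ∷ rs₁) rs = r ∷ Linked-glue (v ∷ xs) rs₁ rs

Unique-middle : ∀ X → Unique (X ++ w ∷ Y) → v ∈ X ++ Y → v ≢ w
Unique-middle [] (w∉Y ∷ _) v∈Y refl = All.lookup w∉Y v∈Y refl
Unique-middle (x ∷ X) (x∉ ∷ _) (here refl) refl = All.lookup x∉ (∈-++⁺ʳ X (here refl)) refl
Unique-middle (x ∷ X) (_ ∷ uniq) (there v∈) = Unique-middle X uniq v∈

∈-delete : ∀ X → v ∈ X ++ w ∷ Y → v ≢ w → v ∈ X ++ Y
∈-delete {w = w} {Y = Y} X v∈ v≢w with ∈-resp-↭ (shift w X Y) v∈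
... | here v≡w = ⊥-elim (v≢w v≡w)
... | there v∈′ = v∈′

∈-undelete : ∀ X → v ∈ X ++ Y → v ∈ X ++ w ∷ Y
∈-undelete {Y = Y} X v∈ with ∈-++⁻ X v∈
... | inj₁ v∈X = ∈-++⁺ˡ v∈X
... | inj₂ v∈Y = ∈-++⁺ʳ X (there v∈Y)

closedPath-delete : ∀ {ℓ} {R : Fin n → Fin n → Set ℓ} P →
  Unique (x ∷ P) → Linked R (x ∷ P ++ [ x ]) → w ∈ x ∷ P →
  ∃ λ Q → Linked R Q × (∀ v → v ∈ Q → v ∈ x ∷ P × v ≢ w) ×
          (∀ v → v ∈ x ∷ P → v ≢ w → v ∈ Q)
closedPath-delete P (x∉P ∷ _) chain (here refl) =
  P , Linked-++⁻ˡ P (Linked.tail chain) ,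
  (λ v v∈P → there v∈P , λ { refl → All.lookup x∉P v∈P refl }) ,
  λ { v (here refl) v≢x → ⊥-elim (v≢x refl) ; v (there v∈P) _ → v∈P }
closedPath-delete {x = x} {w = w} P uniq chain (there w∈P) with ∈-∃++ w∈P
... | A , Bs , refl =
  Bs ++ x ∷ A ,
  Linked-glue Bs (Linked.tail (Linked-++⁻ʳ (x ∷ A) chain′)) (Linked-++⁻ˡ (x ∷ A) chain′) ,
  (λ v v∈ → let v∈′ = ∈-resp-↭ (++-comm Bs (x ∷ A)) v∈ in
            ∈-undelete (x ∷ A) v∈′ , Unique-middle (x ∷ A) uniq v∈′) ,
  λ v v∈ v≢w → ∈-resp-↭ (++-comm (x ∷ A) Bs) (∈-delete (x ∷ A) v∈ v≢w)
  where
  chain′ = subst (Linked _) (cong (x ∷_) (++-assoc A (w ∷ Bs) [ x ])) chain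

closedPath-biconnected : ∀ P → Unique (x ∷ P) → Linked (Adj G) (x ∷ P ++ [ x ]) →
                         Biconnected (induced G (x ∷ P))
closedPath-biconnected {x = x} {G = G} P uniq chain =
  ((x , ∈⇒memᴮ (here refl)) ,
   Linked-AllJoined {G = G} (induced-Induced {G = G} {L = x ∷ P}) (induced-sym {G = G} {L = x ∷ P})
                    (Linked-++⁻ˡ (x ∷ P) chain) (λ _ → ∈⇒memᴮ) (λ _ → memᴮ⇒∈)) ,
  λ w (Lw , ¬joined) → ¬joined (without w (memᴮ⇒∈ Lw))
  where
  without : ∀ w → w ∈ x ∷ P → AllJoined (deleteV (induced G (x ∷ P)) w)
  without w w∈ with Q , chainQ , inQ , coversQ ← closedPath-delete P uniq chain w∈ =
    Linked-AllJoined {G = G} (deleteV-Induced {G = G} {w = w} (induced-Induced {G = G} {L = x ∷ P}))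
      (deleteV-sym {H = induced G (x ∷ P)} {w = w} (induced-sym {G = G} {L = x ∷ P})) chainQ
      (λ v v∈Q → ∧-true⁺ (∈⇒memᴮ (proj₁ (inQ v v∈Q))) (≢⇒not-≟ (proj₂ (inQ v v∈Q))))
      (λ v p → coversQ v (memᴮ⇒∈ (∧-true⁻ˡ p)) (not-≟⇒≢ (∧-true⁻ʳ {memᴮ v (x ∷ P)} p)))

block-induced : IsBlock G B → vs B x ≡ true → vs B y ≡ true → Adj G x y → es B x y ≡ true
block-induced {G = G} {B = B} {x = x} {y = y} blB Bx By xy =
  proj₂ (block-absorbs {G = G} {B = B} {H = induced G (x ∷ y ∷ [])}
                       blB (induced-IsSubgraph {G = G}) edge x≢y Bx By Lx Ly)
        x y (induced-Induced {G = G} x y Lx Ly xy)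
  where
  x≢y = adj⇒≢ {G = G} xy
  Lx : memᴮ x (x ∷ y ∷ []) ≡ true
  Lx = ∈⇒memᴮ (here refl)
  Ly : memᴮ y (x ∷ y ∷ []) ≡ true
  Ly = ∈⇒memᴮ (there (here refl))
  edge : Biconnected (induced G (x ∷ y ∷ []))
  edge = closedPath-biconnected {G = G} (y ∷ []) ((x≢y ∷ []) ∷ [] ∷ [])
                                (xy ∷ adj-sym {G = G} xy ∷ [-])

triangle-in-block : IsBlock G B → vs B x ≡ true → vs B y ≡ true →
                    Adj G x y → Adj G y z → Adj G x z → vs B z ≡ true
triangle-in-block {G = G} {B = B} {x = x} {y = y} {z = z} blB Bx By xy yz xz =
  proj₁ (block-absorbs {G = G} {B = B} {H = induced G (x ∷ y ∷ z ∷ [])}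
                       blB (induced-IsSubgraph {G = G}) triangle
                       (adj⇒≢ {G = G} xy) Bx By (∈⇒memᴮ (here refl)) (∈⇒memᴮ (there (here refl))))
        z (∈⇒memᴮ (there (there (here refl))))
  where
  triangle : Biconnected (induced G (x ∷ y ∷ z ∷ []))
  triangle = closedPath-biconnected {G = G} (y ∷ z ∷ [])
    ((adj⇒≢ {G = G} xy ∷ adj⇒≢ {G = G} xz ∷ []) ∷ (adj⇒≢ {G = G} yz ∷ []) ∷ [] ∷ [])
    (xy ∷ yz ∷ adj-sym {G = G} xz ∷ [-])

-- Paths, bounded search and decidability

lengthʷ : Walk H x y → ℕ
lengthʷ (here _) = zero
lengthʷ (step _ _ W) = suc (lengthʷ W)

verticesʷ : Walk {n} H x y → List (Fin n)
verticesʷ (here {x = x} _) = x ∷ []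
verticesʷ (step {x = x} _ _ W) = x ∷ verticesʷ W

length-verticesʷ : (W : Walk H x y) → length (verticesʷ W) ≡ suc (lengthʷ W)
length-verticesʷ (here _) = refl
length-verticesʷ (step _ _ W) = cong suc (length-verticesʷ W)

verticesʷ-in : (W : Walk H x y) → v ∈ verticesʷ W → vs H v ≡ true
verticesʷ-in (here p) (here refl) = p
verticesʷ-in (step p _ _) (here refl) = p
verticesʷ-in (step _ _ W) (there v∈) = verticesʷ-in W v∈

source∈verticesʷ : (W : Walk H x y) → x ∈ verticesʷ W
source∈verticesʷ (here _) = here refl
source∈verticesʷ (step _ _ _) = here refl

target∈verticesʷ : (W : Walk H x y) → y ∈ verticesʷ W
target∈verticesʷ (here _) = here refl
target∈verticesʷ (step _ _ W) = there (target∈verticesʷ W)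

suffixʷ : (W : Walk H x y) → v ∈ verticesʷ W →
          Σ (Walk H v y) λ W′ → ∃ λ X → verticesʷ W ≡ X ++ verticesʷ W′
suffixʷ W@(here _) (here refl) = W , [] , refl
suffixʷ W@(step _ _ _) (here refl) = W , [] , refl
suffixʷ (step {x = x} _ _ W) (there v∈) with W′ , X , eq ← suffixʷ W v∈ =
  W′ , x ∷ X , cong (x ∷_) eq

Unique-++⁻ʳ : ∀ X → Unique (X ++ Y) → Unique Y
Unique-++⁻ʳ [] uniq = uniq
Unique-++⁻ʳ (x ∷ X) (_ ∷ uniq) = Unique-++⁻ʳ X uniq

Path : Sub n → Fin n → Fin n → Set
Path H x y = Σ (Walk H x y) λ W → Unique (verticesʷ W)

walk⇒path : Walk H x y → Path H x y
walk⇒path (here p) = here p , [] ∷ []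
walk⇒path {x = x} (step p e W) with P , uniq ← walk⇒path W | Any.any? (x ≟_) (verticesʷ P)
... | yes x∈ with P′ , X , eq ← suffixʷ P x∈ = P′ , Unique-++⁻ʳ X (subst Unique eq uniq)
... | no x∉ = step p e P , ¬Any⇒All¬ _ x∉ ∷ uniq

Unique-lookup : ∀ (L : List (Fin n)) → Unique L → ∀ {i j} → i Fin.< j → lookup L i ≢ lookup L j
Unique-lookup (x ∷ L) (x∉ ∷ _) {zero} {suc j} _ eq = All.lookup x∉ (∈-lookup j) eq
Unique-lookup (x ∷ L) (_ ∷ uniq) {suc i} {suc j} (s≤s i<j) = Unique-lookup L uniq i<j

Unique-length≤ : ∀ (L : List (Fin n)) → Unique L → length L ≤ n
Unique-length≤ {n = n} L uniq with length L Data.Nat.≤? n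
... | yes ≤n = ≤n
... | no ≰n with i , j , i<j , eq ← pigeonhole (≰⇒> ≰n) (lookup L) =
  ⊥-elim (Unique-lookup L uniq i<j eq)

path-length< : ((W , _) : Path {n} H x y) → lengthʷ W < n
path-length< {n = n} (W , uniq) = subst (_≤ n) (length-verticesʷ W) (Unique-length≤ (verticesʷ W) uniq)

within : Sub n → (Fin n → Bool) → ℕ → Fin n → Bool
within H S zero x = vs H x ∧ S x
within H S (suc k) x = within H S k x ∨ (vs H x ∧ anyᶠ (λ u → es H x u ∧ within H S k u))

within-sound : ∀ k → within H S k x ≡ true → ∃ λ s → S s ≡ true × Walk H x s
within-sound {H = H} {x = x} zero p = x , ∧-true⁻ʳ {vs H x} p , here (∧-true⁻ˡ p)
within-sound {H = H} {S = S} {x = x} (suc k) p with ∨-true⁻ {within H S k x} p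
... | inj₁ q = within-sound k q
... | inj₂ q with u , r ← anyᶠ-true⁻ (λ u → es H x u ∧ within H S k u) (∧-true⁻ʳ {vs H x} q)
             with s , Ss , W ← within-sound k (∧-true⁻ʳ {es H x u} r) =
  s , Ss , step (∧-true⁻ˡ q) (∧-true⁻ˡ r) W

within-here : ∀ k → vs H x ≡ true → S x ≡ true → within H S k x ≡ true
within-here zero Hx Sx = ∧-true⁺ Hx Sx
within-here (suc k) Hx Sx = ∨-true⁺ˡ (within-here k Hx Sx)

within-complete : (W : Walk H x s) → S s ≡ true → lengthʷ W ≤ k → within H S k x ≡ true
within-complete {k = k} (here Hx) Ss _ = within-here k Hx Ss
within-complete {H = H} {x = x} {S = S} {k = suc k} (step {y = u} Hx e W) Ss (s≤s ≤k) =
  ∨-true⁺ʳ {within H S k x}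
    (∧-true⁺ Hx (anyᶠ-true⁺ (λ u → es H x u ∧ within H S k u)
                             (∧-true⁺ e (within-complete W Ss ≤k))))

walk? : (H : Sub n) → ∀ x y → Dec (Walk H x y)
walk? {n = n} H x y with within H (λ v → ⌊ v ≟ y ⌋) n x in found
... | true with s , s≡y , W ← within-sound n found =
  yes (subst (Walk H x) (isYes-true⁻ (s ≟ y) s≡y) W)
... | false = no λ W → let P = walk⇒path W in
  true⇒≢false (within-complete (proj₁ P) (isYes-true⁺ (y ≟ y) refl) (<⇒≤ (path-length< P))) found

AllJoined? : (H : Sub n) → Dec (AllJoined H)
AllJoined? H = all? λ x → all? λ y → (vs H x ≟ᴮ true) →-dec ((vs H y ≟ᴮ true) →-dec walk? H x y)

Biconnected? : (H : Sub n) → Dec (Biconnected H)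
Biconnected? H = ((any? λ x → vs H x ≟ᴮ true) ×-dec AllJoined? H) ×-dec
                 (all? λ v → ¬? ((vs H v ≟ᴮ true) ×-dec ¬? (AllJoined? (deleteV H v))))

IsSubgraph? : (G : Graph n) (H : Sub n) → Dec (IsSubgraph G H)
IsSubgraph? G H = (all? λ x → all? λ y → es H x y ≟ᴮ es H y x) ×-dec
                  ((all? λ x → all? λ y → (es H x y ≟ᴮ true) →-dec (adj G x y ≟ᴮ true)) ×-dec
                   (all? λ x → all? λ y → (es H x y ≟ᴮ true) →-dec (vs H x ≟ᴮ true)))

_⊑?_ : (A B : Sub n) → Dec (A ⊑ B)
A ⊑? B = (all? λ x → (vs A x ≟ᴮ true) →-dec (vs B x ≟ᴮ true)) ×-dec
         (all? λ x → all? λ y → (es A x y ≟ᴮ true) →-dec (es B x y ≟ᴮ true))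

-- Existence of blocks

functions : ∀ {A : Set} → List A → (k : ℕ) → List (Fin k → A)
functions as zero = Vector.[] ∷ []
functions as (suc k) = cartesianProductWith Vector._∷_ as (functions as k)

-- Completeness is only up to a relation ≈, so that it can be iterated to functions of two arguments.
functions-complete : ∀ {A : Set} (_≈_ : A → A → Set) {as : List A} →
  (∀ a → ∃ λ a′ → a′ ∈ as × a ≈ a′) →
  ∀ k (f : Fin k → A) → ∃ λ g → g ∈ functions as k × (∀ i → f i ≈ g i)
functions-complete _≈_ complete zero f = Vector.[] , here refl , λ ()
functions-complete _≈_ complete (suc k) f
  with a , a∈ , fa ← complete (f zero) | g , g∈ , fg ← functions-complete _≈_ complete k (f ∘ suc) =
  a Vector.∷ g , ∈-cartesianProductWith⁺ Vector._∷_ a∈ g∈ , λ { zero → fa ; (suc i) → fg i }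

bools : List Bool
bools = true ∷ false ∷ []

bools-complete : ∀ a → ∃ λ a′ → a′ ∈ bools × a ≡ a′
bools-complete true = true , here refl , refl
bools-complete false = false , there (here refl) , refl

subgraphs : List (Sub n)
subgraphs {n} = cartesianProductWith sub (functions bools n) (functions (functions bools n) n)

subgraphs-complete : ∀ (H : Sub n) → ∃ λ H′ → H′ ∈ subgraphs × SameSub H H′
subgraphs-complete {n} H
  with V , V∈ , HV ← functions-complete _≡_ bools-complete n (vs H)
     | E , E∈ , HE ← functions-complete (λ f g → ∀ j → f j ≡ g j)
                       (functions-complete _≡_ bools-complete n) n (es H) =
  sub V E , ∈-cartesianProductWith⁺ sub V∈ E∈ , HV , HE

maximal-above : (Q : Sub n → Set) → (∀ H → Dec (Q H)) → Q H → (Hs : List (Sub n)) →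
  ∃ λ M → Q M × H ⊑ M × (∀ H′ → H′ ∈ Hs → Q H′ → M ⊑ H′ → H′ ⊑ M)
maximal-above Q Q? QH [] = _ , QH , ⊑-refl , λ _ ()
maximal-above {H = H} Q Q? QH (H₁ ∷ Hs) with Q? H₁ | H ⊑? H₁
... | yes QH₁ | yes H⊑H₁ with M , QM , H₁⊑M , maximal ← maximal-above Q Q? QH₁ Hs =
  M , QM , ⊑-trans H⊑H₁ H₁⊑M ,
  λ { _ (here refl) _ _ → H₁⊑M ; H′ (there H′∈) → maximal H′ H′∈ }
... | yes _ | no H⋢H₁ with M , QM , H⊑M , maximal ← maximal-above Q Q? QH Hs =
  M , QM , H⊑M ,
  λ { _ (here refl) _ M⊑H₁ → ⊥-elim (H⋢H₁ (⊑-trans H⊑M M⊑H₁))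
    ; H′ (there H′∈) → maximal H′ H′∈ }
... | no ¬QH₁ | _ with M , QM , H⊑M , maximal ← maximal-above Q Q? QH Hs =
  M , QM , H⊑M ,
  λ { _ (here refl) QH₁ _ → ⊥-elim (¬QH₁ QH₁) ; H′ (there H′∈) → maximal H′ H′∈ }

block-containing : IsSubgraph G H → Biconnected H → ∃ λ B → IsBlock G B × H ⊑ B
block-containing {G = G} {H = H} sH bH
  with M , (sM , bM) , H⊑M , maximal ←
         maximal-above (λ K → IsSubgraph G K × Biconnected K)
                       (λ K → IsSubgraph? G K ×-dec Biconnected? K)
                       (sH , bH) subgraphs =
  M , (sM , bM , maximal′) , H⊑M
  where
  maximal′ : ∀ H′ → IsSubgraph G H′ → Biconnected H′ → M ⊑ H′ → H′ ⊑ M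
  maximal′ H′ sH′ bH′ M⊑H′ with K , K∈ , H′≅K ← subgraphs-complete H′ =
    ⊑-trans (SameSub⇒⊑ H′≅K)
            (maximal K K∈ (IsSubgraph-SameSub {G = G} H′≅K sH′ , Biconnected-SameSub H′≅K bH′)
                     (⊑-trans M⊑H′ (SameSub⇒⊑ H′≅K)))

NextModℕ : ℕ → ℕ → ℕ → Set
NextModℕ k a b = (suc a ≡ b) ⊎ ((suc a ≡ k) × (b ≡ zero))

NextModℕ-functional : ∀ {k a b c} → NextModℕ k a b → NextModℕ k a c → b < k → c < k → b ≡ c
NextModℕ-functional (inj₁ refl) (inj₁ refl) _ _ = refl
NextModℕ-functional (inj₁ refl) (inj₂ (refl , _)) b<k _ = contradiction b<k (<-irrefl refl)
NextModℕ-functional (inj₂ (refl , _)) (inj₁ refl) _ c<k = contradiction c<k (<-irrefl refl)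
NextModℕ-functional (inj₂ (_ , refl)) (inj₂ (_ , refl)) _ _ = refl

NextModℕ-asym : ∀ {k a b} → 3 ≤ k → NextModℕ k a b → ¬ NextModℕ k b a
NextModℕ-asym {a = a} _ (inj₁ refl) (inj₁ eq) = m≢1+n+m a (sym eq)
NextModℕ-asym 3≤k (inj₁ refl) (inj₂ (refl , refl)) = contradiction 3≤k λ { (s≤s (s≤s ())) }
NextModℕ-asym 3≤k (inj₂ (refl , refl)) (inj₁ refl) = contradiction 3≤k λ { (s≤s (s≤s ())) }
NextModℕ-asym 3≤k (inj₂ (refl , refl)) (inj₂ (refl , refl)) = contradiction 3≤k λ { (s≤s ()) }

NextModℕ-twice : ∀ {k a b c} → 4 ≤ k → NextModℕ k a b → NextModℕ k b c →
                 a ≢ c × ¬ (NextModℕ k a c ⊎ NextModℕ k c a)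
NextModℕ-twice {a = a} 4≤k (inj₁ refl) (inj₁ refl) =
  m≢1+n+m a ,
  λ { (inj₁ (inj₁ eq)) → 1+n≢n (sym eq) ; (inj₁ (inj₂ (_ , ())))
    ; (inj₂ (inj₁ eq)) → m≢1+n+m a (sym eq)
    ; (inj₂ (inj₂ (refl , refl))) → contradiction 4≤k λ { (s≤s (s≤s (s≤s ()))) } }
NextModℕ-twice 4≤k (inj₁ refl) (inj₂ (refl , refl)) =
  (λ { refl → contradiction 4≤k λ { (s≤s (s≤s ())) } }) ,
  λ { (inj₁ (inj₁ ())) ; (inj₁ (inj₂ (eq , _))) → 1+n≢n (sym eq)
    ; (inj₂ (inj₁ refl)) → contradiction 4≤k λ { (s≤s (s≤s (s≤s ()))) } ; (inj₂ (inj₂ (() , _))) }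
NextModℕ-twice 4≤k (inj₂ (refl , refl)) (inj₁ refl) =
  (λ { refl → contradiction 4≤k λ { (s≤s (s≤s ())) } }) ,
  λ { (inj₁ (inj₁ refl)) → contradiction 4≤k λ { (s≤s ()) } ; (inj₁ (inj₂ (_ , ())))
    ; (inj₂ (inj₁ refl)) → contradiction 4≤k λ { (s≤s (s≤s (s≤s ()))) }
    ; (inj₂ (inj₂ (refl , _))) → contradiction 4≤k λ { (s≤s (s≤s ())) } }
NextModℕ-twice 4≤k (inj₂ (refl , refl)) (inj₂ (refl , refl)) = contradiction 4≤k λ { (s≤s ()) }

module Cyclic {k′ : ℕ} where

  NextMod-functional : ∀ {i j j′ : Fin (suc k′)} →
                       NextMod (suc k′) i j → NextMod (suc k′) i j′ → j ≡ j′
  NextMod-functional {j = j} {j′} p q = toℕ-injective (NextModℕ-functional p q (toℕ<n j) (toℕ<n j′))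

  next : Fin (suc k′) → Fin (suc k′)
  next i with suc (toℕ i) Data.Nat.<? suc k′
  ... | yes i+1<k = Fin.fromℕ< i+1<k
  ... | no _ = zero

  next-NextMod : ∀ i → NextMod (suc k′) i (next i)
  next-NextMod i with suc (toℕ i) Data.Nat.<? suc k′
  ... | yes i+1<k = inj₁ (sym (toℕ-fromℕ< i+1<k))
  ... | no i+1≮k = inj₂ (≤-antisym (toℕ<n i) (≮⇒≥ i+1≮k) , refl)

  prev : Fin (suc k′) → Fin (suc k′)
  prev zero = Fin.fromℕ k′
  prev (suc j) = Fin.inject₁ j

  prev-NextMod : ∀ i → NextMod (suc k′) (prev i) i
  prev-NextMod zero = inj₂ (cong suc (toℕ-fromℕ k′) , refl)
  prev-NextMod (suc j) = inj₁ (cong suc (toℕ-inject₁ j))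

  next-prev : ∀ i → next (prev i) ≡ i
  next-prev i = NextMod-functional (next-NextMod (prev i)) (prev-NextMod i)

  next-induction : (X : Fin (suc k′) → Set) → (∀ j → X j → X (next j)) →
                   ∀ {i} → X i → ∀ j → X j
  next-induction X closed {i} Xi = <-weakInduction X X₀ up
    where
    up : ∀ j → X (Fin.inject₁ j) → X (suc j)
    up j Xj = subst X (next-prev (suc j)) (closed _ Xj)
    X₀ : X zero
    X₀ = subst X (next-prev zero) (closed _ (<-weakInduction-startingFrom X Xi up (≤fromℕ i)))

C₃-complete : ∀ (i j : Fin 3) → i ≢ j → CycAdj 3 i j
C₃-complete zero zero i≢j = contradiction refl i≢j
C₃-complete zero (suc zero) _ = inj₁ (inj₁ refl)
C₃-complete zero (suc (suc zero)) _ = inj₂ (inj₂ (refl , refl))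
C₃-complete (suc zero) zero _ = inj₂ (inj₁ refl)
C₃-complete (suc zero) (suc zero) i≢j = contradiction refl i≢j
C₃-complete (suc zero) (suc (suc zero)) _ = inj₁ (inj₁ refl)
C₃-complete (suc (suc zero)) zero _ = inj₁ (inj₂ (refl , refl))
C₃-complete (suc (suc zero)) (suc zero) _ = inj₂ (inj₁ refl)
C₃-complete (suc (suc zero)) (suc (suc zero)) i≢j = contradiction refl i≢j

-- Distance to a set of vertices

least : (ℕ → Bool) → ℕ → ℕ
least p zero = zero
least p (suc b) with p zero
... | true = zero
... | false = suc (least (p ∘ suc) b)

least-holds : ∀ (p : ℕ → Bool) b {j} → j ≤ b → p j ≡ true → p (least p b) ≡ true
least-holds p zero z≤n pj = pj
least-holds p (suc b) {j} j≤b pj with p zero in p0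
... | true = p0
least-holds p (suc b) {zero} _ pj | false = contradiction p0 (true⇒≢false pj)
least-holds p (suc b) {suc j} (s≤s j≤b) pj | false = least-holds (p ∘ suc) b j≤b pj

least-below : ∀ (p : ℕ → Bool) b {j} → j < least p b → p j ≡ false
least-below p (suc b) {j} j< with p zero in p0
least-below p (suc b) {zero} _ | false = p0
least-below p (suc b) {suc j} (s≤s j<) | false = least-below (p ∘ suc) b j<

module Distance {n : ℕ} (G : Graph n) (connected : ConnectedGraph G)
                (S : Fin n → Bool) {s₀ : Fin n} (s₀∈S : S s₀ ≡ true) where

  Near : ℕ → Fin n → Bool
  Near = within (whole G) S

  route : ∀ x → Walk (whole G) x s₀
  route x = proj₂ connected x s₀ refl refl

  dist : Fin n → ℕ
  dist x = least (λ k → Near k x) (lengthʷ (route x))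

  Near-dist : ∀ x → Near (dist x) x ≡ true
  Near-dist x =
    least-holds (λ k → Near k x) (lengthʷ (route x)) ≤-refl (within-complete (route x) s₀∈S ≤-refl)

  dist-≤ : ∀ x {k} → Near k x ≡ true → dist x ≤ k
  dist-≤ x {k} near with dist x Data.Nat.≤? k
  ... | yes ≤k = ≤k
  ... | no ≰k =
    contradiction (least-below (λ k → Near k x) (lengthʷ (route x)) (≰⇒> ≰k)) (true⇒≢false near)

  dist≡0⇒S : dist x ≡ 0 → S x ≡ true
  dist≡0⇒S {x = x} eq = subst (λ k → Near k x ≡ true) eq (Near-dist x)

  S⇒dist≡0 : S x ≡ true → dist x ≡ 0
  S⇒dist≡0 {x = x} Sx = n≤0⇒n≡0 (dist-≤ x {0} Sx)

  dist-adj : Adj G x y → dist x ≤ suc (dist y)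
  dist-adj {x = x} {y = y} xy =
    dist-≤ x (∨-true⁺ʳ {Near (dist y) x}
      (anyᶠ-true⁺ (λ u → adj G x u ∧ Near (dist y) u) (∧-true⁺ xy (Near-dist y))))

  dist-parent : ∀ {j} → dist x ≡ suc j → ∃ λ p → Adj G x p × dist p ≡ j
  dist-parent {x = x} {j} eq with ∨-true⁻ {Near j x} (subst (λ k → Near k x ≡ true) eq (Near-dist x))
  ... | inj₁ near = contradiction (subst (_≤ j) eq (dist-≤ x near)) (<-irrefl refl)
  ... | inj₂ near with p , q ← anyᶠ-true⁻ (λ u → adj G x u ∧ Near j u) near =
    p , ∧-true⁻ˡ q ,
    ≤-antisym (dist-≤ p (∧-true⁻ʳ {adj G x p} q))
              (≤-pred (subst (_≤ suc (dist p)) eq (dist-adj (∧-true⁻ˡ q))))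

  toward-S-avoiding : ∀ m → dist u ≡ m → u ≢ v → dist u ≤ dist v →
                      ∃ λ s → S s ≡ true × Walk (deleteV (whole G) v) u s
  toward-S-avoiding {u = u} zero du≡0 u≢v _ = u , dist≡0⇒S du≡0 , here (≢⇒not-≟ u≢v)
  toward-S-avoiding {u = u} {v = v} (suc m) du≡ u≢v du≤dv with p , up , dp≡m ← dist-parent du≡ =
    let dp<dv = <-≤-trans (subst₂ _<_ (sym dp≡m) (sym du≡) (n<1+n m)) du≤dv
        p≢v = λ (p≡v : p ≡ v) → <-irrefl (cong dist p≡v) dp<dv
        (s , Ss , W) = toward-S-avoiding m dp≡m p≢v (<⇒≤ dp<dv)
    in s , Ss ,
       step (≢⇒not-≟ u≢v) (∧-true⁺ up (∧-true⁺ (≢⇒not-≟ u≢v) (≢⇒not-≟ p≢v))) W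

-- Blocks that are cycles

long-cycle-vertex : IsLongCycle B → ∃ λ x → vs B x ≡ true
long-cycle-vertex (suc _ , _ , _ , f , _ , f-in , _) = f zero , f-in zero

module CycleBlock {n : ℕ} {G : Graph n} {B : Sub n} (blB : IsBlock G B)
                  {k′ : ℕ} (cycle : IsCycleOfLength B (suc k′)) where

  open Cyclic {k′} public

  f : Fin (suc k′) → Fin n
  f = proj₁ (proj₂ cycle)

  f-injective : ∀ {i j} → f i ≡ f j → i ≡ j
  f-injective = proj₁ (proj₂ (proj₂ cycle)) _ _

  f-in : ∀ i → vs B (f i) ≡ true
  f-in = proj₁ (proj₂ (proj₂ (proj₂ cycle)))

  f-onto : vs B x ≡ true → ∃ λ i → f i ≡ x
  f-onto = proj₁ (proj₂ (proj₂ (proj₂ (proj₂ cycle)))) _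

  f-adj : ∀ i j → (es B (f i) (f j) ≡ true) ⇔ CycAdj (suc k′) i j
  f-adj = proj₂ (proj₂ (proj₂ (proj₂ (proj₂ cycle))))

  CycAdj⇒adj : ∀ {i j} → CycAdj (suc k′) i j → Adj G (f i) (f j)
  CycAdj⇒adj {i} {j} ij = proj₁ (proj₂ (proj₁ blB)) _ _ (Equivalence.from (f-adj i j) ij)

  CycAdj-complete⇒adj : (∀ i j → i ≢ j → CycAdj (suc k′) i j) →
                        vs B x ≡ true → vs B y ≡ true → x ≢ y → Adj G x y
  CycAdj-complete⇒adj complete Bx By x≢y with i , refl ← f-onto Bx | j , refl ← f-onto By =
    CycAdj⇒adj (complete i j (x≢y ∘ cong f))

  adj-next : ∀ i → Adj G (f i) (f (next i))
  adj-next i = CycAdj⇒adj (inj₁ (next-NextMod i))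

  adj⇒CycAdj : ∀ {i j} → Adj G (f i) (f j) → CycAdj (suc k′) i j
  adj⇒CycAdj {i} {j} fifj =
    Equivalence.to (f-adj i j) (block-induced {G = G} {B = B} blB (f-in i) (f-in j) fifj)

module OnePerfectOrientation {n : ℕ} (G : Graph n) (connected : ConnectedGraph G)
                             {D : Fin n → Fin n → Bool} (orientation : IsOrientation G D)
                             (perfect : IsOnePerfect G D) where

  Arc : Fin n → Fin n → Set
  Arc x y = D x y ≡ true

  arc⇒adj : Arc x y → Adj G x y
  arc⇒adj = proj₁ orientation _ _

  arc-either : Adj G x y → Arc x y ⊎ Arc y x
  arc-either xy with proj₂ orientation _ _ xy
  ... | inj₁ (x→y , _) = inj₁ x→y
  ... | inj₂ (_ , y→x) = inj₂ y→x

  out-neighbour-in-long-cycle : IsBlock G B → IsLongCycle B → vs B x ≡ true →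
                                ∃ λ w → vs B w ≡ true × Arc x w
  out-neighbour-in-long-cycle {B = B} blB (suc k′ , 4≤k , cycle) Bx
    with i , refl ← CycleBlock.f-onto {G = G} {B = B} blB cycle Bx
       | arc-either (CycleBlock.adj-next {G = G} {B = B} blB cycle i)
  ... | inj₁ forward = _ , CycleBlock.f-in {G = G} {B = B} blB cycle _ , forward
  ... | inj₂ backward =
    f (prev i) , f-in _ ,
    subst (λ j → Arc (f j) (f (prev i))) (next-prev i)
          (next-induction Backward propagate backward (prev i))
    where
    open CycleBlock {G = G} {B = B} blB cycle
    Backward : Fin (suc k′) → Set
    Backward j = Arc (f (next j)) (f j)
    propagate : ∀ j → Backward j → Backward (next j)
    propagate j back with arc-either (adj-next (next j))
    ... | inj₂ back′ = back′
    ... | inj₁ forward =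
      contradiction (adj⇒CycAdj (perfect _ _ _ back forward (far ∘ cong toℕ ∘ f-injective))) not-adjacent
      where
      far-and-not-adjacent = NextModℕ-twice 4≤k (next-NextMod j) (next-NextMod (next j))
      far = proj₁ far-and-not-adjacent
      not-adjacent = proj₂ far-and-not-adjacent

  arc-stays-in-long-cycle-block : IsBlock G B → IsLongCycle B → vs B x ≡ true → Arc x u → vs B u ≡ true
  arc-stays-in-long-cycle-block {B = B} {u = u} blB long Bx x→u
    with w , Bw , x→w ← out-neighbour-in-long-cycle {B = B} blB long Bx | w ≟ u
  ... | yes refl = Bw
  ... | no w≢u =
    triangle-in-block {G = G} {B = B} blB Bx Bw (arc⇒adj x→w) (perfect _ _ _ x→w x→u w≢u) (arc⇒adj x→u)

  module DistanceToLongCycleBlock (blB : IsBlock G B) (long : IsLongCycle B) where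
    open Distance G connected (vs B) (proj₂ (long-cycle-vertex {B = B} long))

    no-arc-away : ∀ j → dist u ≡ j → dist t ≡ suc j → ¬ Arc u t
    no-arc-away zero du dt u→t =
      contradiction (trans (sym dt) (S⇒dist≡0 (arc-stays-in-long-cycle-block blB long (dist≡0⇒S du) u→t)))
                    λ ()
    no-arc-away {t = t} (suc j) du dt u→t with q , uq , dq ← dist-parent du | arc-either uq
    ... | inj₂ q→u = no-arc-away j dq du q→u
    ... | inj₁ u→q =
      contradiction (subst₂ _≤_ dt (cong suc dq) (dist-adj (perfect _ _ _ u→t u→q t≢q)))
                    λ { (s≤s le) → <-irrefl refl le }
      where
      t≢q : t ≢ q
      t≢q refl = m≢1+n+m _ (trans (sym dq) dt)

    reaches-B : IsBlock G B′ → IsLongCycle B′ → ∀ j → vs B′ x ≡ true → dist x ≡ j →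
                ∃ λ y → vs B′ y ≡ true × vs B y ≡ true
    reaches-B _ _ zero B′x dx = _ , B′x , dist≡0⇒S dx
    reaches-B blB′ long′ (suc j) B′x dx with p , xp , dp ← dist-parent dx | arc-either xp
    ... | inj₁ x→p = reaches-B blB′ long′ j (arc-stays-in-long-cycle-block blB′ long′ B′x x→p) dp
    ... | inj₂ p→x = contradiction p→x (no-arc-away j dp dx)

  long-cycle-blocks-coincide : IsBlock G B → IsBlock G B′ → IsLongCycle B → IsLongCycle B′ →
                               SameSub B B′
  long-cycle-blocks-coincide {B = B} {B′ = B′} blB blB′ long long′
    with x₀ , B′x₀ ← long-cycle-vertex {B = B′} long′
    with x , B′x , Bx ← DistanceToLongCycleBlock.reaches-B blB long blB′ long′ _ B′x₀ refl
    with w , B′w , x→w ← out-neighbour-in-long-cycle blB′ long′ B′x =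
    blocks-coincide {G = G} {B = B} {B′ = B′} blB blB′ (adj⇒≢ {G = G} (arc⇒adj x→w))
                    Bx (arc-stays-in-long-cycle-block blB long Bx x→w) B′x B′w

onePerfectlyOrientable⇒atMostOneLongCycleBlock :
  ConnectedGraph G → OnePerfectlyOrientable G → AtMostOneLongCycleBlock G
onePerfectlyOrientable⇒atMostOneLongCycleBlock {G = G} connected (_ , orientation , perfect)
                                               B B′ blB blB′ =
  OnePerfectOrientation.long-cycle-blocks-coincide G connected orientation perfect blB blB′

-- Orientations of block-cactus graphs

block-with-nonadjacent-pair-is-long-cycle : BlockCactus G → IsBlock G B →
  vs B y ≡ true → vs B z ≡ true → y ≢ z → ¬ Adj G y z → IsLongCycle B
block-with-nonadjacent-pair-is-long-cycle {G = G} {B = B} cactus blB By Bz y≢z ¬yz with cactus B blB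
... | inj₂ complete = contradiction (proj₁ (proj₂ (proj₁ blB)) _ _ (complete _ _ By Bz y≢z)) ¬yz
... | inj₁ (k , cycle@(3≤k , _)) with m≤n⇒m<n∨m≡n 3≤k
...   | inj₁ 4≤k = k , 4≤k , cycle
...   | inj₂ refl =
  contradiction (CycleBlock.CycAdj-complete⇒adj {G = G} {B = B} blB cycle C₃-complete By Bz y≢z) ¬yz

walk-Linked : (∀ a b → es H a b ≡ true → Adj G a b) → Adj G u x → (W : Walk H x y) → Adj G y t →
              Linked (Adj G) (u ∷ verticesʷ W ++ [ t ])
walk-Linked edge ux (here _) yt = ux ∷ yt ∷ [-]
walk-Linked {G = G} edge ux (step _ e W) yt = ux ∷ walk-Linked {G = G} edge (edge _ _ e) W yt

whole-sym : SymmetricEdges (whole G)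
whole-sym {G = G} _ _ = adj-sym {G = G}

avoiding-path-closes-cycle : ((W , _) : Path (deleteV (whole G) v) y z) → Adj G v y → Adj G v z →
                             Biconnected (induced G (v ∷ verticesʷ W))
avoiding-path-closes-cycle {G = G} {v = v} (W , uniq) vy vz =
  closedPath-biconnected {G = G} (verticesʷ W) (All.tabulate v∉W ∷ uniq)
    (walk-Linked {G = G} (λ _ _ → ∧-true⁻ˡ) vy W (adj-sym {G = G} vz))
  where
  v∉W : ∀ {u} → u ∈ verticesʷ W → v ≢ u
  v∉W u∈ v≡u = not-≟⇒≢ (verticesʷ-in W u∈) (sym v≡u)

OneWay : (Fin n → Fin n → Bool) → Fin n → Fin n → Set
OneWay D x y = (D x y ≡ true × D y x ≡ false) ⊎ (D x y ≡ false × D y x ≡ true)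

module Layered {n : ℕ} (G : Graph n) (d : Fin n → ℕ) (T : Fin n → Fin n → Bool) where

  Lower : Fin n → Fin n → Set
  Lower v y = d y < d v ⊎ (d y ≡ d v × T v y ≡ true)

  lower? : ∀ v y → Dec (Lower v y)
  lower? v y = (d y Data.Nat.<? d v) ⊎-dec ((d y Data.Nat.≟ d v) ×-dec (T v y ≟ᴮ true))

  Lower⇒≤ : Lower v y → d y ≤ d v
  Lower⇒≤ (inj₁ dy<dv) = <⇒≤ dy<dv
  Lower⇒≤ (inj₂ (dy≡dv , _)) = ≤-reflexive dy≡dv

  higher-not-Lower : d v < d y → ¬ Lower v y
  higher-not-Lower dv<dy (inj₁ dy<dv) = <-asym dv<dy dy<dv
  higher-not-Lower dv<dy (inj₂ (dy≡dv , _)) = <-irrefl (sym dy≡dv) dv<dy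

  level-not-Lower : d v ≡ d y → T v y ≡ false → ¬ Lower v y
  level-not-Lower dv≡dy _ (inj₁ dy<dv) = <-irrefl (sym dv≡dy) dy<dv
  level-not-Lower _ Tvy≡false (inj₂ (_ , Tvy)) = true⇒≢false Tvy Tvy≡false

  downward : Fin n → Fin n → Bool
  downward v y = adj G v y ∧ ⌊ lower? v y ⌋

  downward-true⁺ : Adj G v y → Lower v y → downward v y ≡ true
  downward-true⁺ {v = v} {y = y} vy low = ∧-true⁺ vy (isYes-true⁺ (lower? v y) low)

  downward-false⁺ : ¬ Lower v y → downward v y ≡ false
  downward-false⁺ {v = v} {y = y} ¬low =
    trans (cong (adj G v y ∧_) (isYes-false⁺ (lower? v y) ¬low)) (∧-zeroʳ _)

  downward-true⁻ : downward v y ≡ true → Adj G v y × Lower v y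
  downward-true⁻ {v = v} {y = y} p = ∧-true⁻ˡ p , isYes-true⁻ (lower? v y) (∧-true⁻ʳ {adj G v y} p)

  TieBreak : Set
  TieBreak = ∀ x y → Adj G x y → d x ≡ d y → OneWay T x y

  downward-IsOrientation : TieBreak → IsOrientation G downward
  downward-IsOrientation tie = (λ _ _ → ∧-true⁻ˡ) , λ x y xy → by-distance x y xy (<-cmp (d x) (d y))
    where
    by-distance : ∀ x y → Adj G x y → _ → OneWay downward x y
    by-distance x y xy (tri< dx<dy _ _) =
      inj₂ (downward-false⁺ (higher-not-Lower dx<dy) , downward-true⁺ (adj-sym {G = G} xy) (inj₁ dx<dy))
    by-distance x y xy (tri> _ _ dy<dx) =
      inj₁ (downward-true⁺ xy (inj₁ dy<dx) , downward-false⁺ (higher-not-Lower dy<dx))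
    by-distance x y xy (tri≈ _ dx≡dy _) with tie x y xy dx≡dy
    ... | inj₁ (Txy , Tyx) =
      inj₁ (downward-true⁺ xy (inj₂ (sym dx≡dy , Txy)) ,
            downward-false⁺ (level-not-Lower (sym dx≡dy) Tyx))
    ... | inj₂ (Txy , Tyx) =
      inj₂ (downward-false⁺ (level-not-Lower dx≡dy Txy) ,
            downward-true⁺ (adj-sym {G = G} xy) (inj₂ (dx≡dy , Tyx)))

  downward-IsOnePerfect :
    (∀ v y z → Adj G v y → Adj G v z → Lower v y → Lower v z → y ≢ z → Adj G y z) →
    IsOnePerfect G downward
  downward-IsOnePerfect clique v y z vy vz y≢z =
    clique v y z (proj₁ (downward-true⁻ vy)) (proj₁ (downward-true⁻ vz))
                 (proj₂ (downward-true⁻ vy)) (proj₂ (downward-true⁻ vz)) y≢z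

module Wedges {n : ℕ} (G : Graph n) (connected : ConnectedGraph G) (cactus : BlockCactus G)
              (S : Fin n → Bool) {s₀ : Fin n} (s₀∈S : S s₀ ≡ true) where

  open Distance G connected S s₀∈S public

  OpenWedge : Fin n → Fin n → Fin n → Set
  OpenWedge v y z = Adj G v y × Adj G v z × dist y ≤ dist v × dist z ≤ dist v × 1 ≤ dist v ×
                    y ≢ z × ¬ Adj G y z

  openWedge? : ∀ v y z → Dec (OpenWedge v y z)
  openWedge? v y z =
    (adj G v y ≟ᴮ true) ×-dec (adj G v z ≟ᴮ true) ×-dec (dist y Data.Nat.≤? dist v) ×-dec
    (dist z Data.Nat.≤? dist v) ×-dec (1 Data.Nat.≤? dist v) ×-dec
    ¬? (y ≟ z) ×-dec ¬? (adj G y z ≟ᴮ true)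

  JoinedAvoiding : Set
  JoinedAvoiding = ∀ v → 1 ≤ dist v → ∀ a b → S a ≡ true → S b ≡ true →
                   Walk (deleteV (whole G) v) a b

  wedge-path : JoinedAvoiding → OpenWedge v y z → Path (deleteV (whole G) v) y z
  wedge-path {v = v} joined (vy , vz , dy , dz , dv , _)
    with sy , Sy , Wy ← toward-S-avoiding _ refl (adj⇒≢ {G = G} (adj-sym {G = G} vy)) dy
       | sz , Sz , Wz ← toward-S-avoiding _ refl (adj⇒≢ {G = G} (adj-sym {G = G} vz)) dz =
    walk⇒path (Wy ++ʷ joined v dv sy sz Sy Sz ++ʷ
               reverseʷ (deleteV-sym {H = whole G} {w = v} (whole-sym {G = G})) Wz)

  open-wedge-on-long-cycle-block : JoinedAvoiding → OpenWedge v y z →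
                                   ∃ λ B → IsBlock G B × IsLongCycle B × vs B v ≡ true
  open-wedge-on-long-cycle-block {v = v} {y = y} {z = z} joined wedge@(vy , vz , _ , _ , _ , y≢z , ¬yz)
    with P ← wedge-path joined wedge
    with B , blB , C⊑B ← block-containing {G = G} {H = induced G (v ∷ verticesʷ (proj₁ P))}
                           (induced-IsSubgraph {G = G} {L = v ∷ verticesʷ (proj₁ P)})
                           (avoiding-path-closes-cycle {G = G} P vy vz) =
    B , blB ,
    block-with-nonadjacent-pair-is-long-cycle {G = G} {B = B} cactus blB
      (proj₁ C⊑B _ (∈⇒memᴮ (there (source∈verticesʷ (proj₁ P)))))
      (proj₁ C⊑B _ (∈⇒memᴮ (there (target∈verticesʷ (proj₁ P))))) y≢z ¬yz ,
    proj₁ C⊑B _ (∈⇒memᴮ (here refl))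

  orientable-by-distance : (T : Fin n → Fin n → Bool) → Layered.TieBreak G dist T →
    (∀ v y z → dist v ≡ 0 → Adj G v y → Adj G v z →
       Layered.Lower G dist T v y → Layered.Lower G dist T v z → y ≢ z → Adj G y z) →
    (∀ v y z → ¬ OpenWedge v y z) → OnePerfectlyOrientable G
  orientable-by-distance T tie bottom no-wedge =
    downward , downward-IsOrientation tie , downward-IsOnePerfect clique
    where
    open Layered G dist T
    clique : ∀ v y z → Adj G v y → Adj G v z → Lower v y → Lower v z → y ≢ z → Adj G y z
    clique v y z vy vz ly lz y≢z with dist v Data.Nat.≟ 0
    ... | yes dv≡0 = bottom v y z dv≡0 vy vz ly lz y≢z
    ... | no dv≢0 = decidable-stable (adj G y z ≟ᴮ true) λ ¬yz →
      no-wedge v y z (vy , vz , Lower⇒≤ ly , Lower⇒≤ lz , n≢0⇒n>0 dv≢0 , y≢z , ¬yz)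

index-order : Fin n → Fin n → Bool
index-order x y = ⌊ x Fin.<? y ⌋

index-order-OneWay : x ≢ y → OneWay index-order x y
index-order-OneWay {x = x} {y = y} x≢y with Fin.<-cmp x y
... | tri< x<y _ y≮x = inj₁ (isYes-true⁺ (x Fin.<? y) x<y , isYes-false⁺ (y Fin.<? x) y≮x)
... | tri≈ _ x≡y _ = contradiction x≡y x≢y
... | tri> x≮y _ y<x = inj₂ (isYes-false⁺ (x Fin.<? y) x≮y , isYes-true⁺ (y Fin.<? x) y<x)

module AroundLongCycleBlock {n : ℕ} (G : Graph n) (connected : ConnectedGraph G)
                            (cactus : BlockCactus G) {C : Sub n} (blC : IsBlock G C)
                            {k′ : ℕ} (4≤k : 4 ≤ suc k′) (cycle : IsCycleOfLength C (suc k′)) where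

  open CycleBlock {G = G} {B = C} blC cycle
  open Wedges G connected cactus (vs C) (f-in zero)
  open Layered G dist using (Lower; TieBreak)

  successor? : ∀ x y → Dec (∃ λ i → f i ≡ x × f (next i) ≡ y)
  successor? x y = any? λ i → (f i ≟ x) ×-dec (f (next i) ≟ y)

  successor : Fin n → Fin n → Bool
  successor x y = ⌊ successor? x y ⌋

  successor-true : ∀ {i j} → NextMod (suc k′) i j → successor (f i) (f j) ≡ true
  successor-true {i} {j} nm =
    isYes-true⁺ (successor? (f i) (f j)) (i , refl , cong f (NextMod-functional (next-NextMod i) nm))

  successor-false : ∀ {i j} → NextMod (suc k′) i j → successor (f j) (f i) ≡ false
  successor-false {i} {j} nm = isYes-false⁺ (successor? (f j) (f i)) λ (i′ , fi′≡fj , fni′≡fi) →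
    NextModℕ-asym (proj₁ cycle) nm
      (subst₂ (NextMod (suc k′)) (f-injective fi′≡fj) (f-injective fni′≡fi) (next-NextMod i′))

  successor-unique : successor x y ≡ true → successor x z ≡ true → y ≡ z
  successor-unique {x = x} {y = y} {z = z} sy sz
    with i , fi≡x , fni≡y ← isYes-true⁻ (successor? x y) sy
       | j , fj≡x , fnj≡z ← isYes-true⁻ (successor? x z) sz =
    trans (sym fni≡y) (trans (cong (f ∘ next) (f-injective (trans fi≡x (sym fj≡x)))) fnj≡z)

  T : Fin n → Fin n → Bool
  T x y = if vs C x then successor x y else index-order x y

  T-on-C : vs C x ≡ true → T x y ≡ successor x y
  T-on-C {x = x} {y = y} Cx = cong (λ b → if b then successor x y else index-order x y) Cx

  tie : TieBreak T
  tie x y xy dx≡dy with vs C x in Cx | vs C y in Cy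
  ... | true | false = contradiction (dist≡0⇒S (trans (sym dx≡dy) (S⇒dist≡0 Cx))) (flip true⇒≢false Cy)
  ... | false | true = contradiction (dist≡0⇒S (trans dx≡dy (S⇒dist≡0 Cy))) (flip true⇒≢false Cx)
  ... | false | false = index-order-OneWay (adj⇒≢ {G = G} xy)
  ... | true | true with i , refl ← f-onto Cx | j , refl ← f-onto Cy with adj⇒CycAdj xy
  ...   | inj₁ nm = inj₁ (successor-true nm , successor-false nm)
  ...   | inj₂ nm = inj₂ (successor-false nm , successor-true nm)

  bottom : ∀ v y z → dist v ≡ 0 → Adj G v y → Adj G v z → Lower T v y → Lower T v z → y ≢ z →
           Adj G y z
  bottom v y z dv≡0 _ _ ly lz = contradiction (successor-unique (successor-below ly) (successor-below lz))
    where
    successor-below : Lower T v u → successor v u ≡ true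
    successor-below (inj₁ du<dv) = contradiction (subst (_ <_) dv≡0 du<dv) λ ()
    successor-below (inj₂ (_ , Tvu)) = trans (sym (T-on-C (dist≡0⇒S dv≡0))) Tvu

  joined : JoinedAvoiding
  joined v dv a b Ca Cb =
    mapʷ (λ x Cx → ≢⇒not-≟ (off-C Cx))
         (λ x y Cx Cy xy → ∧-true⁺ (proj₁ (proj₂ (proj₁ blC)) x y xy)
                                   (∧-true⁺ (≢⇒not-≟ (off-C Cx)) (≢⇒not-≟ (off-C Cy))))
         (proj₂ (proj₁ (proj₁ (proj₂ blC))) a b Ca Cb)
    where
    off-C : vs C x ≡ true → x ≢ v
    off-C Cx refl = contradiction (subst (1 ≤_) (S⇒dist≡0 Cx) dv) λ ()

  no-wedge : AtMostOneLongCycleBlock G → ∀ v y z → ¬ OpenWedge v y z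
  no-wedge unique v y z wedge =
    contradiction (subst (1 ≤_) (S⇒dist≡0 (on-C (open-wedge-on-long-cycle-block joined wedge))) dv) λ ()
    where
    dv = proj₁ (proj₂ (proj₂ (proj₂ (proj₂ wedge))))
    on-C : (∃ λ B → IsBlock G B × IsLongCycle B × vs B v ≡ true) → vs C v ≡ true
    on-C (B , blB , long , Bv) = trans (sym (proj₁ (unique B C blB blC long (suc k′ , 4≤k , cycle)) v)) Bv

  orientable : AtMostOneLongCycleBlock G → OnePerfectlyOrientable G
  orientable unique = orientable-by-distance T tie bottom (no-wedge unique)

module Construction {n : ℕ} (G : Graph n) (connected : ConnectedGraph G) (cactus : BlockCactus G) where

  root : Fin n
  root = proj₁ (proj₁ connected)

  module Rooted = Wedges G connected cactus (λ x → ⌊ x ≟ root ⌋) (isYes-true⁺ (root ≟ root) refl)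

  rooted-joined : Rooted.JoinedAvoiding
  rooted-joined v dv a b a≡root b≡root
    with refl ← isYes-true⁻ (a ≟ root) a≡root | refl ← isYes-true⁻ (b ≟ root) b≡root =
    here (≢⇒not-≟ λ { refl → contradiction (subst (1 ≤_) (Rooted.S⇒dist≡0 a≡root) dv) λ () })

  at-root : Rooted.dist x ≡ 0 → x ≡ root
  at-root {x = x} d≡0 = isYes-true⁻ (x ≟ root) (Rooted.dist≡0⇒S d≡0)

  rooted-bottom : ∀ v y z → Rooted.dist v ≡ 0 → Adj G v y → Adj G v z →
    Layered.Lower G Rooted.dist index-order v y → Layered.Lower G Rooted.dist index-order v z →
    y ≢ z → Adj G y z
  rooted-bottom v y z dv≡0 vy _ ly _ _ =
    contradiction (trans (at-root dv≡0) (sym (at-root (n≤0⇒n≡0 (subst (_ ≤_) dv≡0 dy≤dv)))))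
                  (adj⇒≢ {G = G} vy)
    where dy≤dv = Layered.Lower⇒≤ G Rooted.dist index-order ly

  orientable : AtMostOneLongCycleBlock G → OnePerfectlyOrientable G
  orientable unique = by-wedges (any? λ v → any? λ y → any? λ z → Rooted.openWedge? v y z)
    where
    around : ∀ C → IsBlock G C → IsLongCycle C → OnePerfectlyOrientable G
    around C blC (suc k′ , 4≤k , cycle) =
      AroundLongCycleBlock.orientable G connected cactus {C = C} blC 4≤k cycle unique
    by-wedges : Dec (∃ λ v → ∃ λ y → ∃ λ z → Rooted.OpenWedge v y z) → OnePerfectlyOrientable G
    by-wedges (yes (v , y , z , wedge)) =
      let (C , blC , long , _) = Rooted.open-wedge-on-long-cycle-block rooted-joined wedge
      in around C blC long
    by-wedges (no ¬wedge) =
      Rooted.orientable-by-distance index-order (λ x y xy _ → index-order-OneWay (adj⇒≢ {G = G} xy))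
        rooted-bottom λ v y z wedge → ¬wedge (v , y , z , wedge)

corollary13 : ∀ {n : ℕ} (G : Graph n) → ConnectedGraph G → BlockCactus G →
    OnePerfectlyOrientable G ⇔ AtMostOneLongCycleBlock G
corollary13 G connected cactus =
  mk⇔ (onePerfectlyOrientable⇒atMostOneLongCycleBlock {G = G} connected)
      (Construction.orientable G connected cactus)
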